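{- Let $m\ge1,n\ge0$, identify $a_i=s_i$ for $i=1,\dots,m$ so that $A=S\setminus\{s_0\}$. If $(R,T)\in\mathfrak{S\!C}_{m,n}^{\bullet}$, then $(\overline{R},\overline{T})\in\mathfrak{A\!C}_{m,n}^{\bullet}$, where $\overline{R}=R\cap(A\times C)$ and $\overline{T}=T\cap(C\times A)$.
   Context: For posets $(P,\le_P)$, $(Q,\le_Q)$ on disjoint ground sets and $R\subseteq P\times Q$, $T\subseteq Q\times P$, define $\le_{R,T}$ on $P\cup Q$ by: $x\le_{R,T}y$ iff $x\le_P y$, or $x\le_Q y$, or $(x,y)\in R$, or $(x,y)\in T$. $(R,T)$ is a merging if $\le_{R,T}$ is reflexive and transitive, and a proper merging if moreover $R\cap T^{ -1}=\emptyset$. The $m$-star is the poset on $S=\{s_0,\dots,s_m\}$ with $s\le s'$ iff $s=s'$ or $s=s_0$; the $m$-antichain is the poset on $A=\{a_1,\dots,a_m\}$ with only the trivial relations $a_i\le a_i$; the $n$-chain is the poset on $C=\{c_1,\dots,c_n\}$ with $c_i\le c_j$ iff $i\le j$. $\mathfrak{S\!C}_{m,n}^{\bullet}$ is the set of proper mergings $(R,T)$, $R\subseteq S\times C$, $T\subseteq C\times S$, of the $m$-star and the $n$-chain; $\mathfrak{A\!C}_{m,n}^{\bullet}$ is the set of proper mergings $(R,T)$, $R\subseteq A\times C$, $T\subseteq C\times A$, of the $m$-antichain and the $n$-chain. -}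

module Defs where

open import Level using (0ℓ)
open import Data.Nat using (ℕ; suc; _≤_)
open import Data.Fin using (Fin; zero; suc; toℕ)
open import Data.Sum using (_⊎_; inj₁; inj₂)
open import Data.Product using (_×_)
open import Data.Empty using (⊥)
open import Relation.Nullary using (¬_)
open import Relation.Binary.PropositionalEquality using (_≡_)
open import Relation.Binary.Core using (Rel; REL)
open import Relation.Binary.Definitions using (Reflexive; Transitive)

_≤[_,_,_,_]_ : {P Q : Set} → P ⊎ Q → Rel P 0ℓ → Rel Q 0ℓ → REL P Q 0ℓ → REL Q P 0ℓ → P ⊎ Q → Set
inj₁ x ≤[ ≤P , ≤Q , R , T ] inj₁ y = ≤P x y
inj₂ x ≤[ ≤P , ≤Q , R , T ] inj₂ y = ≤Q x y
inj₁ x ≤[ ≤P , ≤Q , R , T ] inj₂ y = R x y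
inj₂ x ≤[ ≤P , ≤Q , R , T ] inj₁ y = T x y

record IsMerging {P Q : Set} (≤P : Rel P 0ℓ) (≤Q : Rel Q 0ℓ)
                 (R : REL P Q 0ℓ) (T : REL Q P 0ℓ) : Set where
  field
    refl′  : Reflexive (λ x y → x ≤[ ≤P , ≤Q , R , T ] y)
    trans′ : Transitive (λ x y → x ≤[ ≤P , ≤Q , R , T ] y)

record IsProperMerging {P Q : Set} (≤P : Rel P 0ℓ) (≤Q : Rel Q 0ℓ)
                       (R : REL P Q 0ℓ) (T : REL Q P 0ℓ) : Set where
  field
    merging : IsMerging ≤P ≤Q R T
    proper  : ∀ p q → ¬ (R p q × T q p)

-- m-star on S = Fin (suc m); zero is s₀, suc i is s_{i+1}.
-- s ≤ s' iff s = s' or s = s₀.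
StarLe : (m : ℕ) → Rel (Fin (suc m)) 0ℓ
StarLe m s s' = (s ≡ s') ⊎ (s ≡ zero)

-- m-antichain on A = Fin m; index i stands for a_{i+1}.
AntichainLe : (m : ℕ) → Rel (Fin m) 0ℓ
AntichainLe m a a' = a ≡ a'

-- n-chain on C = Fin n; index i stands for c_{i+1}; c_i ≤ c_j iff i ≤ j.
ChainLe : (n : ℕ) → Rel (Fin n) 0ℓ
ChainLe n c c' = toℕ c ≤ toℕ c'

SC● : (m n : ℕ) → REL (Fin (suc m)) (Fin n) 0ℓ → REL (Fin n) (Fin (suc m)) 0ℓ → Set
SC● m n R T = IsProperMerging (StarLe m) (ChainLe n) R T

AC● : (m n : ℕ) → REL (Fin m) (Fin n) 0ℓ → REL (Fin n) (Fin m) 0ℓ → Set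
AC● m n R T = IsProperMerging (AntichainLe m) (ChainLe n) R T

-- Restrictions R̄ = R ∩ (A × C), T̄ = T ∩ (C × A), under a_i = s_i (a ↦ suc a).
restrictR : {m n : ℕ} → REL (Fin (suc m)) (Fin n) 0ℓ → REL (Fin m) (Fin n) 0ℓ
restrictR R a c = R (suc a) c

restrictT : {m n : ℕ} → REL (Fin n) (Fin (suc m)) 0ℓ → REL (Fin n) (Fin m) 0ℓ
restrictT T c a = T c (suc a)

module Submission where

-- Restricting a merging along an order embedding gives a merging.
-- Let f : P′ → P satisfy  x ≤P′ y ⇔ f x ≤P f y.  Extending f by the identity
-- on Q gives a map  P′ ⊎ Q → P ⊎ Q  which, for any (R,T), both preserves and
-- reflects the merged orders ≤_{R∘f, T∘f} and ≤_{R,T}.  Reflexivity and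
-- transitivity of ≤_{R,T} therefore pull back to ≤_{R∘f, T∘f}, and
-- properness (R ∩ T⁻¹ = ∅) pulls back pointwise.
--
-- Lemma 3.2 is the instance f = suc, whose
-- restrictions are exactly R̄ and T̄.

open import Defs
open import Level using (0ℓ)
open import Data.Nat using (ℕ; suc; _≤_)
open import Data.Fin using (Fin)
import Data.Fin as Fin
open import Data.Fin.Properties using (suc-injective)
open import Data.Sum using (_⊎_; inj₁; inj₂; map₁)
open import Relation.Binary.PropositionalEquality using (_≡_; cong)
open import Relation.Binary.Core using (Rel; REL)

module PullBack {P′ P Q : Set} {≤P′ : Rel P′ 0ℓ} {≤P : Rel P 0ℓ} {≤Q : Rel Q 0ℓ}
                (f : P′ → P)
                (preserves : ∀ {x y} → ≤P′ x y → ≤P (f x) (f y))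
                (reflects  : ∀ {x y} → ≤P (f x) (f y) → ≤P′ x y)
                (R : REL P Q 0ℓ) (T : REL Q P 0ℓ) where

  R′ : REL P′ Q 0ℓ
  R′ a c = R (f a) c

  T′ : REL Q P′ 0ℓ
  T′ c a = T c (f a)

  embed : P′ ⊎ Q → P ⊎ Q
  embed = map₁ f

  embed-preserves : ∀ x y → x ≤[ ≤P′ , ≤Q , R′ , T′ ] y → embed x ≤[ ≤P , ≤Q , R , T ] embed y
  embed-preserves (inj₁ a) (inj₁ b) a≤b = preserves a≤b
  embed-preserves (inj₁ a) (inj₂ c) aRc = aRc
  embed-preserves (inj₂ c) (inj₁ b) cTb = cTb
  embed-preserves (inj₂ c) (inj₂ d) c≤d = c≤d

  embed-reflects : ∀ x y → embed x ≤[ ≤P , ≤Q , R , T ] embed y → x ≤[ ≤P′ , ≤Q , R′ , T′ ] y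
  embed-reflects (inj₁ a) (inj₁ b) fa≤fb = reflects fa≤fb
  embed-reflects (inj₁ a) (inj₂ c) aRc = aRc
  embed-reflects (inj₂ c) (inj₁ b) cTb = cTb
  embed-reflects (inj₂ c) (inj₂ d) c≤d = c≤d

  pullback-merging : IsMerging ≤P ≤Q R T → IsMerging ≤P′ ≤Q R′ T′
  pullback-merging mg = record
    { refl′  = λ {x} → embed-reflects x x (refl′ {embed x})
    ; trans′ = λ {x} {y} {z} x≤y y≤z → embed-reflects x z
        (trans′ {embed x} {embed y} {embed z} (embed-preserves x y x≤y) (embed-preserves y z y≤z))
    }
    where open IsMerging mg

  pullback-proper : IsProperMerging ≤P ≤Q R T → IsProperMerging ≤P′ ≤Q R′ T′
  pullback-proper pm = record
    { merging = pullback-merging (IsProperMerging.merging pm)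
    ; proper  = λ a c → IsProperMerging.proper pm (f a) c
    }

suc-preserves : ∀ {m} {a b : Fin m} → AntichainLe m a b → StarLe m (Fin.suc a) (Fin.suc b)
suc-preserves a≡b = inj₁ (cong Fin.suc a≡b)

-- a_i ↦ s_i reflects order: s_i ≤ s_j with i, j ≥ 1 forces i = j, since s_i ≠ s₀.
suc-reflects : ∀ {m} {a b : Fin m} → StarLe m (Fin.suc a) (Fin.suc b) → AntichainLe m a b
suc-reflects (inj₁ sa≡sb) = suc-injective sa≡sb
suc-reflects (inj₂ ())

lemma3p2 : (m n : ℕ) → 1 ≤ m → (R : REL (Fin (suc m)) (Fin n) 0ℓ) → (T : REL (Fin n) (Fin (suc m)) 0ℓ)
    → SC● m n R T → AC● m n (restrictR {m} {n} R) (restrictT {m} {n} T)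
lemma3p2 m n _ R T = PullBack.pullback-proper Fin.suc suc-preserves suc-reflects R T
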